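{- Let $T=(V,E)$ be a tree with $n$ vertices. Then $\sum_{v\in V}\mathcal{U}_T(v)=\binom{n}{2}+IGL(T)$.
   Context: For a graph $G=(V,E)$, $d_G(u,v)$ is the number of edges of a shortest $u$–$v$ path, or $\infty$ if none exists, with $1/\infty=0$; $IGL(G)=\sum_{\{u,v\}\subseteq V}\frac1{d_G(u,v)}$ over unordered pairs of distinct vertices. The utility of $S\subseteq V$ is $\mathcal{U}_G(S)=IGL(G)-IGL(G-S)$, and $\mathcal{U}_G(v)=\mathcal{U}_G(\{v\})$. -}

module Defs where

open import Data.Nat using (ℕ; zero; suc; _<_; _≤_)
open import Data.Nat.Combinatorics using (_C_)
open import Data.Bool using (Bool; true; false; _∧_; _∨_; not; if_then_else_)
open import Data.Fin using (Fin; toℕ)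
open import Data.Fin.Subset using (Subset; _∈_; _∉_; ⁅_⁆)
open import Data.List using (List; []; _∷_; length; last; head)
open import Data.List.Relation.Unary.Linked using (Linked)
open import Data.List.Relation.Unary.Unique.Propositional using (Unique)
open import Data.Maybe using (Maybe; just; nothing)
open import Data.Product using (Σ; _×_; ∃)
open import Data.Integer using (+_)
open import Data.Rational using (ℚ; _/_; 0ℚ) renaming (_+_ to _+ℚ_)
open import Relation.Binary.PropositionalEquality using (_≡_)
open import Relation.Nullary using (¬_; does)
open import Data.Fin.Properties using (_<?_)
open import Data.Fin.Subset.Properties using (_∈?_)
import Data.Fin as Fin
import Data.Rational as Q
open import Data.Fin.Subset using (⊤; ∁)

record Graph (n : ℕ) : Set where
  field
    adj   : Fin n → Fin n → Bool
    sym   : ∀ u v → adj u v ≡ adj v u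
    irrefl : ∀ v → adj v v ≡ false
open Graph public

∑ : {n : ℕ} → (Fin n → ℚ) → ℚ
∑ {zero}  f = 0ℚ
∑ {suc n} f = f Fin.zero +ℚ ∑ (λ i → f (Fin.suc i))

∑pairs : {n : ℕ} → (Fin n → Fin n → ℚ) → ℚ
∑pairs f = ∑ (λ u → ∑ (λ v → if does (u <? v) then f u v else 0ℚ))

-- Graph G - S, modelled on the full vertex set: A is the set of surviving
-- vertices; edges are those of G with both ends in A.
-- within A k u v = true iff there is a u–v walk in G[A] with at most k edges
-- (u, v ∈ A).
anyFin : {n : ℕ} → (Fin n → Bool) → Bool
anyFin {zero}  p = false
anyFin {suc n} p = p Fin.zero ∨ anyFin (λ i → p (Fin.suc i))

inA : {n : ℕ} → Subset n → Fin n → Bool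
inA A v = does (v ∈? A)

adjIn : {n : ℕ} → Graph n → Subset n → Fin n → Fin n → Bool
adjIn G A u v = inA A u ∧ inA A v ∧ adj G u v

within : {n : ℕ} → Graph n → Subset n → ℕ → Fin n → Fin n → Bool
within G A zero    u v = inA A u ∧ does (u Fin.≟ v)
within G A (suc k) u v =
  within G A k u v ∨ anyFin (λ w → adjIn G A u w ∧ within G A k w v)

-- Since a shortest path in a graph on n vertices has < n edges,
-- searching k = 0 … n suffices, so this is d_{G[A]}(u,v) (nothing = ∞).
search : {n : ℕ} → Graph n → Subset n → Fin n → Fin n → ℕ → ℕ → Maybe ℕ
search G A u v k zero    = if within G A k u v then just k else nothing
search G A u v k (suc r) = if within G A k u v then just k else search G A u v (suc k) r

dist : {n : ℕ} → Graph n → Subset n → Fin n → Fin n → Maybe ℕ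
dist {n} G A u v = search G A u v 0 n

-- 1 / d, with 1/∞ = 0 (d = 0 never occurs for distinct vertices; mapped to 0).
recip : Maybe ℕ → ℚ
recip nothing        = 0ℚ
recip (just zero)    = 0ℚ
recip (just (suc k)) = + 1 / suc k

IGLon : {n : ℕ} → Graph n → Subset n → ℚ
IGLon G A = ∑pairs (λ u v → if inA A u ∧ inA A v then recip (dist G A u v) else 0ℚ)

IGL : {n : ℕ} → Graph n → ℚ
IGL G = IGLon G ⊤

IGL-del : {n : ℕ} → Graph n → Subset n → ℚ
IGL-del G S = IGLon G (∁ S)

utility : {n : ℕ} → Graph n → Subset n → ℚ
utility G S = IGL G Q.- IGL-del G S

utilityV : {n : ℕ} → Graph n → Fin n → ℚ
utilityV G v = utility G ⁅ v ⁆

Adjacent : {n : ℕ} → Graph n → Fin n → Fin n → Set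
Adjacent G u v = adj G u v ≡ true

record Cycle {n : ℕ} (G : Graph n) : Set where
  field
    verts    : List (Fin n)
    long     : 3 ≤ length verts
    distinct : Unique verts
    chain    : Linked (Adjacent G) verts
    closes   : ∃ λ a → ∃ λ b → head verts ≡ just a × last verts ≡ just b × Adjacent G b a

record Path {n : ℕ} (G : Graph n) (u v : Fin n) : Set where
  field
    verts : List (Fin n)
    start : head verts ≡ just u
    end   : last verts ≡ just v
    chain : Linked (Adjacent G) verts

Connected : {n : ℕ} → Graph n → Set
Connected G = ∀ u v → Path G u v

IsTree : {n : ℕ} → Graph n → Set
IsTree G = Connected G × ¬ Cycle G

module Submission where

-- Let a ≠ b be at distance d in the tree T, joined by the unique path P with d + 1 vertices.
-- Deleting a vertex v of P disconnects a from b (or deletes one of them), because a detour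
-- around v would close a cycle; deleting any other vertex leaves P, hence the distance d,
-- intact. So the pair {a, b} contributes 1/d to U_T(v) exactly for the d + 1 vertices v of P,
-- in total (d + 1)/d = 1 + 1/d, and summing over the C(n,2) pairs gives C(n,2) + IGL(T).

open import Defs hiding (sym)
open import Algebra.Bundles using (CommutativeRing)
open import Data.Bool using (Bool; true; false; T; _∧_; if_then_else_)
open import Data.Bool.Properties using (T-∧; T-∨; T-≡; T?; if-cong-then; if-eta)
open import Data.Fin as Fin using (Fin; zero; suc)
open import Data.Fin.Properties using (_≟_; _<?_; <⇒≢; injective⇒≤)
open import Data.Fin.Subset using (Subset; _∈_; _⊆_; ⊤; ∁; ⁅_⁆)
open import Data.Fin.Subset.Properties
  using (_∈?_; ∈⊤; ⊆⊤; x∈∁p⇒x∉p; x∉p⇒x∈∁p; x∈⁅x⁆; x∈⁅y⁆⇒x≡y)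
open import Data.Integer as ℤ using (+_)
import Data.Integer.Properties as ℤP
open import Data.List using (List; []; _∷_; length; last; head; lookup)
open import Data.List.Membership.Propositional using () renaming (_∈_ to _∈ₗ_)
open import Data.List.Membership.Propositional.Properties using (∈-lookup)
import Data.List.Membership.DecPropositional as DecMembership
open import Data.List.Relation.Unary.All as All using ([])
open import Data.List.Relation.Unary.AllPairs using ([]; _∷_)
open import Data.List.Relation.Unary.Any using (here; there)
open import Data.List.Relation.Unary.Linked using (Linked; [-]; _∷_)
open import Data.List.Relation.Unary.Unique.Propositional using (Unique)
open import Data.Maybe using (just; nothing)
open import Data.Nat as ℕ using (ℕ; zero; suc; _≤_; _<_; z≤n; s≤s)
open import Data.Nat.Combinatorics using (_C_; nCk+nC[k+1]≡[n+1]C[k+1]; nC1≡n)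
open import Data.Nat.Coprimality as Coprime using (1-coprimeTo)
open import Data.Nat.Induction using (<-wellFounded)
open import Data.Nat.Properties
  using ( ≤-refl; ≤-trans; ≤-antisym; ≤-pred; <⇒≤; <⇒≱; ≰⇒>; ≤∧≢⇒<; m≤n⇒m≤1+n
        ; +-suc; +-identityʳ; +-comm)
open import Data.Product using (Σ; ∃-syntax; _×_; _,_; proj₁; proj₂)
open import Data.Rational using (ℚ; _/_; _+_; _-_; -_; _*_; 1/_; 0ℚ; 1ℚ; mkℚ)
import Data.Rational.Properties as ℚP
open import Data.Sum using (inj₁; inj₂)
open import Function using (_∘_; Injective)
open import Function.Bundles using (module Equivalence)
open import Induction.WellFounded using (Acc; acc)
open import Relation.Nullary using (¬_; Dec; does; yes; no)
open import Relation.Nullary.Decidable using (dec-true)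
open import Relation.Nullary.Negation using (contradiction)
open import Relation.Binary.PropositionalEquality
  using (_≡_; _≢_; refl; sym; trans; cong; cong₂; subst; module ≡-Reasoning)

import Algebra.Properties.CommutativeMonoid.Sum ℚP.+-0-commutativeMonoid as Sum
open import Algebra.Properties.Semiring.Mult (CommutativeRing.semiring ℚP.+-*-commutativeRing)
  using (×-homo-+; ×-assoc-*) renaming (_×_ to _·_)

open Equivalence using (to; from)
open ≡-Reasoning

/1-coprime : ∀ m → + m / 1 ≡ mkℚ (+ m) 0 (Coprime.sym (1-coprimeTo m))
/1-coprime m = ℚP.normalize-coprime _

/1-suc : ∀ m → + suc m / 1 ≡ 1ℚ + + m / 1
/1-suc m = begin
  + suc m / 1                ≡⟨ cong (λ i → (+ 1 ℤ.+ i) / 1) (sym (ℤP.*-identityʳ (+ m))) ⟩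
  -- the normal form of 1ℚ + mkℚ (+ m) 0 _
  (+ 1 ℤ.+ + m ℤ.* + 1) / 1  ≡⟨ cong (_+_ 1ℚ) (sym (/1-coprime m)) ⟩
  1ℚ + + m / 1               ∎

·1≡/1 : ∀ m → m · 1ℚ ≡ + m / 1
·1≡/1 zero    = refl
·1≡/1 (suc m) = trans (cong (_+_ 1ℚ) (·1≡/1 m)) (sym (/1-suc m))

·-reciprocal : ∀ e → suc e · (+ 1 / suc e) ≡ 1ℚ
·-reciprocal e = begin
  1+e · q              ≡⟨ cong (1+e ·_) (sym (ℚP.*-identityˡ q)) ⟩
  1+e · (1ℚ * q)       ≡⟨ sym (×-assoc-* 1+e 1ℚ q) ⟩
  (1+e · 1ℚ) * q       ≡⟨ cong (_* q) (·1≡/1 1+e) ⟩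
  (+ 1+e / 1) * q      ≡⟨ cong₂ _*_ (/1-coprime 1+e) (ℚP.normalize-coprime (1-coprimeTo 1+e)) ⟩
  -- 1/ p computes to mkℚ (+ 1) e _, the normal form of q
  p * 1/ p             ≡⟨ ℚP.*-inverseʳ p ⟩
  1ℚ                   ∎
  where
  1+e : ℕ
  1+e = suc e
  q p : ℚ
  q = + 1 / 1+e
  p = mkℚ (+ 1+e) 0 (Coprime.sym (1-coprimeTo 1+e))

∑≡sum : ∀ {n} (f : Fin n → ℚ) → ∑ f ≡ Sum.sum f
∑≡sum {zero}  f = refl
∑≡sum {suc n} f = cong (_+_ (f zero)) (∑≡sum (f ∘ suc))

∑-cong : ∀ {n} {f g : Fin n → ℚ} → (∀ i → f i ≡ g i) → ∑ f ≡ ∑ g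
∑-cong {zero}  f≗g = refl
∑-cong {suc n} f≗g = cong₂ _+_ (f≗g zero) (∑-cong (f≗g ∘ suc))

∑-const : ∀ n (x : ℚ) → ∑ {n} (λ _ → x) ≡ n · x
∑-const n x = trans (∑≡sum {n} _) (Sum.sum-replicate n)

∑-zero : ∀ n → ∑ {n} (λ _ → 0ℚ) ≡ 0ℚ
∑-zero n = trans (∑≡sum {n} _) (Sum.sum-replicate-zero n)

∑-distrib-+ : ∀ {n} (f g : Fin n → ℚ) → ∑ (λ i → f i + g i) ≡ ∑ f + ∑ g
∑-distrib-+ {n} f g = begin
  ∑ (λ i → f i + g i)        ≡⟨ ∑≡sum {n} _ ⟩
  Sum.sum (λ i → f i + g i)  ≡⟨ Sum.∑-distrib-+ f g ⟩
  Sum.sum f + Sum.sum g      ≡⟨ sym (cong₂ _+_ (∑≡sum f) (∑≡sum g)) ⟩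
  ∑ f + ∑ g                  ∎

∑-neg : ∀ {n} (f : Fin n → ℚ) → ∑ (λ i → - f i) ≡ - ∑ f
∑-neg {zero}  f = refl
∑-neg {suc n} f =
  trans (cong (_+_ (- f zero)) (∑-neg (f ∘ suc))) (sym (ℚP.neg-distrib-+ (f zero) _))

∑-distrib-− : ∀ {n} (f g : Fin n → ℚ) → ∑ (λ i → f i - g i) ≡ ∑ f - ∑ g
∑-distrib-− f g = trans (∑-distrib-+ f (-_ ∘ g)) (cong (_+_ (∑ f)) (∑-neg g))

∑-comm : ∀ {m n} (h : Fin m → Fin n → ℚ) → ∑ (λ i → ∑ (h i)) ≡ ∑ (λ j → ∑ (λ i → h i j))
∑-comm h = trans (∑∑≡sum h) (trans (Sum.∑-comm h) (sym (∑∑≡sum (λ j i → h i j))))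
  where
  ∑∑≡sum : ∀ {m n} (h : Fin m → Fin n → ℚ) → ∑ (λ i → ∑ (h i)) ≡ Sum.sum (λ i → Sum.sum (h i))
  ∑∑≡sum {m} h = trans (∑-cong (∑≡sum ∘ h)) (∑≡sum {m} _)

∑-if : ∀ {n} c (f : Fin n → ℚ) → ∑ (λ i → if c then f i else 0ℚ) ≡ (if c then ∑ f else 0ℚ)
∑-if     true  f = refl
∑-if {n} false f = ∑-zero n

∑-≟ : ∀ {n} (y : Fin n) (x : ℚ) → ∑ (λ v → if does (v ≟ y) then x else 0ℚ) ≡ x
∑-≟ {suc n} zero    x = trans (cong (_+_ x) (∑-zero n)) (ℚP.+-identityʳ x)
∑-≟ {suc n} (suc y) x = trans (ℚP.+-identityˡ _) (∑-≟ y x)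

_∈ₗ?_ : ∀ {n} (x : Fin n) (xs : List (Fin n)) → Dec (x ∈ₗ xs)
_∈ₗ?_ {n} = DecMembership._∈?_ (_≟_ {n})

infix 4 _∈ₗ?_

∑-∈ : ∀ {n} {xs : List (Fin n)} → Unique xs → ∀ x →
      ∑ (λ v → if does (v ∈ₗ? xs) then x else 0ℚ) ≡ length xs · x
∑-∈ {n} {[]}     _             x = ∑-zero n
∑-∈ {n} {y ∷ xs} (y∉xs ∷ uxs) x = begin
  ∑ (λ v → if does (v ∈ₗ? y ∷ xs) then x else 0ℚ)
    ≡⟨ ∑-cong split ⟩
  ∑ (λ v → (if does (v ≟ y) then x else 0ℚ) + (if does (v ∈ₗ? xs) then x else 0ℚ))
    ≡⟨ ∑-distrib-+ (λ v → if does (v ≟ y) then x else 0ℚ) _ ⟩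
  ∑ (λ v → if does (v ≟ y) then x else 0ℚ) + ∑ (λ v → if does (v ∈ₗ? xs) then x else 0ℚ)
    ≡⟨ cong₂ _+_ (∑-≟ y x) (∑-∈ uxs x) ⟩
  x + length xs · x ∎
  where
  split : ∀ v → (if does (v ∈ₗ? y ∷ xs) then x else 0ℚ)
              ≡ (if does (v ≟ y) then x else 0ℚ) + (if does (v ∈ₗ? xs) then x else 0ℚ)
  split v with v ≟ y | v ∈ₗ? xs
  ... | yes refl | yes v∈xs = contradiction refl (All.lookup y∉xs v∈xs)
  ... | yes refl | no  _    = sym (ℚP.+-identityʳ x)
  ... | no  _    | yes _    = sym (ℚP.+-identityˡ x)
  ... | no  _    | no  _    = refl

∑pairs-cong : ∀ {n} {f g : Fin n → Fin n → ℚ} → (∀ {a b} → a Fin.< b → f a b ≡ g a b) →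
              ∑pairs f ≡ ∑pairs g
∑pairs-cong f≗g = ∑-cong λ a → ∑-cong λ b → if-does-cong (a <? b) f≗g
  where
  if-does-cong : ∀ {P : Set} (P? : Dec P) {x y : ℚ} → (P → x ≡ y) →
                 (if does P? then x else 0ℚ) ≡ (if does P? then y else 0ℚ)
  if-does-cong (yes p) x≡y = x≡y p
  if-does-cong (no  _) _   = refl

∑pairs-distrib : (_∙_ : ℚ → ℚ → ℚ) → 0ℚ ∙ 0ℚ ≡ 0ℚ →
                 (∀ {m} (f g : Fin m → ℚ) → ∑ (λ i → f i ∙ g i) ≡ ∑ f ∙ ∑ g) →
                 ∀ {n} (f g : Fin n → Fin n → ℚ) →
                 ∑pairs (λ a b → f a b ∙ g a b) ≡ ∑pairs f ∙ ∑pairs g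
∑pairs-distrib _∙_ 0∙0≡0 ∑-distrib {n} f g =
  trans (∑-cong λ a → trans (∑-cong λ b → if-distrib (does (a <? b)) (f a b) (g a b))
                            (∑-distrib (upper f a) (upper g a)))
        (∑-distrib (λ a → ∑ (upper f a)) (λ a → ∑ (upper g a)))
  where
  upper : (Fin n → Fin n → ℚ) → Fin n → Fin n → ℚ
  upper h a b = if does (a <? b) then h a b else 0ℚ

  if-distrib : ∀ c x y → (if c then x ∙ y else 0ℚ) ≡ (if c then x else 0ℚ) ∙ (if c then y else 0ℚ)
  if-distrib true  _ _ = refl
  if-distrib false _ _ = sym 0∙0≡0

∑-∑pairs-comm : ∀ {m n} (h : Fin m → Fin n → Fin n → ℚ) →
                ∑ (λ v → ∑pairs (h v)) ≡ ∑pairs (λ a b → ∑ (λ v → h v a b))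
∑-∑pairs-comm h = begin
  ∑ (λ v → ∑ (λ a → ∑ (λ b → if does (a <? b) then h v a b else 0ℚ)))
    ≡⟨ ∑-comm (λ v a → ∑ (λ b → if does (a <? b) then h v a b else 0ℚ)) ⟩
  ∑ (λ a → ∑ (λ v → ∑ (λ b → if does (a <? b) then h v a b else 0ℚ)))
    ≡⟨ ∑-cong (λ a → ∑-comm (λ v b → if does (a <? b) then h v a b else 0ℚ)) ⟩
  ∑ (λ a → ∑ (λ b → ∑ (λ v → if does (a <? b) then h v a b else 0ℚ)))
    ≡⟨ ∑-cong (λ a → ∑-cong λ b → ∑-if (does (a <? b)) (λ v → h v a b)) ⟩
  ∑pairs (λ a b → ∑ (λ v → h v a b)) ∎

∑pairs-suc : ∀ {n} (f : Fin (suc n) → Fin (suc n) → ℚ) →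
             ∑pairs f ≡ ∑ (λ b → f zero (suc b)) + ∑pairs (λ a b → f (suc a) (suc b))
-- The guards comparing with zero compute, leaving only the additive zeros to remove.
∑pairs-suc f = cong₂ _+_
  (ℚP.+-identityˡ (∑ (λ b → f zero (suc b))))
  (∑-cong λ a → ℚP.+-identityˡ (∑ (λ b → if does (a <? b) then f (suc a) (suc b) else 0ℚ)))

∑pairs-const : ∀ n (x : ℚ) → ∑pairs {n} (λ _ _ → x) ≡ (n C 2) · x
∑pairs-const zero    x = refl
∑pairs-const (suc n) x = begin
  ∑pairs {suc n} (λ _ _ → x)                ≡⟨ ∑pairs-suc {n} (λ _ _ → x) ⟩
  ∑ {n} (λ _ → x) + ∑pairs {n} (λ _ _ → x)  ≡⟨ cong₂ _+_ (∑-const n x) (∑pairs-const n x) ⟩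
  n · x + (n C 2) · x                       ≡⟨ sym (×-homo-+ x n (n C 2)) ⟩
  (n ℕ.+ n C 2) · x                         ≡⟨ cong (λ k → (k ℕ.+ n C 2) · x) (sym (nC1≡n n)) ⟩
  (n C 1 ℕ.+ n C 2) · x                     ≡⟨ cong (_· x) (nCk+nC[k+1]≡[n+1]C[k+1] n 1) ⟩
  (suc n C 2) · x                           ∎

lookup-injective : ∀ {A : Set} {xs : List A} → Unique xs → Injective _≡_ _≡_ (lookup xs)
lookup-injective (_    ∷ _)   {zero}  {zero}  _  = refl
lookup-injective (x∉xs ∷ _)   {zero}  {suc j} eq = contradiction eq (All.lookup x∉xs (∈-lookup j))
lookup-injective (x∉xs ∷ _)   {suc i} {zero}  eq = contradiction (sym eq) (All.lookup x∉xs (∈-lookup i))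
lookup-injective (_    ∷ uxs) {suc i} {suc j} eq = cong suc (lookup-injective uxs eq)

unique⇒length≤ : ∀ {n} {xs : List (Fin n)} → Unique xs → length xs ≤ n
unique⇒length≤ uxs = injective⇒≤ (lookup-injective uxs)

does-sound : ∀ {P : Set} (P? : Dec P) → T (does P?) → P
does-sound (yes p) _ = p

does-complete : ∀ {P : Set} (P? : Dec P) → P → T (does P?)
does-complete (yes _) _ = _
does-complete (no ¬p) p = ¬p p

anyFin-sound : ∀ {n} (p : Fin n → Bool) → T (anyFin p) → ∃[ i ] T (p i)
anyFin-sound {suc n} p t with to (T-∨ {p zero}) t
... | inj₁ t₀ = zero , t₀
... | inj₂ t₁ with anyFin-sound (p ∘ suc) t₁
...   | i , tᵢ = suc i , tᵢ

anyFin-complete : ∀ {n} (p : Fin n → Bool) i → T (p i) → T (anyFin p)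
anyFin-complete p zero    t = from (T-∨ {p zero}) (inj₁ t)
anyFin-complete p (suc i) t = from (T-∨ {p zero}) (inj₂ (anyFin-complete (p ∘ suc) i t))

x∈∁⁅y⁆⇒x≢y : ∀ {n} {x y : Fin n} → x ∈ ∁ ⁅ y ⁆ → x ≢ y
x∈∁⁅y⁆⇒x≢y {y = y} x∈∁⁅y⁆ refl = x∈∁p⇒x∉p x∈∁⁅y⁆ (x∈⁅x⁆ y)

x≢y⇒x∈∁⁅y⁆ : ∀ {n} {x y : Fin n} → x ≢ y → x ∈ ∁ ⁅ y ⁆
x≢y⇒x∈∁⁅y⁆ {y = y} x≢y = x∉p⇒x∈∁p (x≢y ∘ x∈⁅y⁆⇒x≡y y)

module Walks {n : ℕ} (G : Graph n) where

  data Walk (A : Subset n) : ℕ → Fin n → Fin n → Set where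
    [_]  : ∀ {u} → u ∈ A → Walk A 0 u u
    step : ∀ {k u w v} → u ∈ A → Adjacent G u w → Walk A k w v → Walk A (suc k) u v

  private
    variable
      A B : Subset n
      j k d : ℕ
      a b u v w x : Fin n

  IsShortest : Walk A d u v → Set
  IsShortest {A = A} {d = d} {u = u} {v = v} _ = ∀ {k} → Walk A k u v → d ≤ k

  start∈ : Walk A k u v → u ∈ A
  start∈ [ u∈A ]        = u∈A
  start∈ (step u∈A _ _) = u∈A

  -- vertices p unfolds to u ∷ _ whatever p is, so Linked and last compute on it.
  mutual
    vertices : Walk A k u v → List (Fin n)
    vertices {u = u} p = u ∷ later-vertices p

    later-vertices : Walk A k u v → List (Fin n)
    later-vertices [ _ ]        = []
    later-vertices (step _ _ p) = vertices p

  vertices-length : (p : Walk A k u v) → length (vertices p) ≡ suc k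
  vertices-length [ _ ]        = refl
  vertices-length (step _ _ p) = cong suc (vertices-length p)

  vertices-last : (p : Walk A k u v) → last (vertices p) ≡ just v
  vertices-last [ _ ]        = refl
  vertices-last (step _ _ p) = vertices-last p

  vertices-linked : (p : Walk A k u v) → Linked (Adjacent G) (vertices p)
  vertices-linked [ _ ]          = [-]
  vertices-linked (step _ u~w p) = u~w ∷ vertices-linked p

  end∈vertices : (p : Walk A k u v) → v ∈ₗ vertices p
  end∈vertices [ _ ]        = here refl
  end∈vertices (step _ _ p) = there (end∈vertices p)

  ∈vertices⇒∈ : (p : Walk A k u v) → x ∈ₗ vertices p → x ∈ A
  ∈vertices⇒∈ p (here refl)           = start∈ p
  ∈vertices⇒∈ (step _ _ p) (there x∈p) = ∈vertices⇒∈ p x∈p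

  end∈ : Walk A k u v → v ∈ A
  end∈ p = ∈vertices⇒∈ p (end∈vertices p)

  suffix : (p : Walk A k u v) → x ∈ₗ vertices p → ∃[ j ] j ≤ k × Walk A j x v
  suffix p            (here refl) = _ , ≤-refl , p
  suffix (step _ _ p) (there x∈p) with suffix p x∈p
  ... | j , j≤k , q = j , m≤n⇒m≤1+n j≤k , q

  restrict : (p : Walk A k u v) → (∀ {x} → x ∈ₗ vertices p → x ∈ B) → Walk B k u v
  restrict [ _ ]          ⊆B = [ ⊆B (here refl) ]
  restrict (step _ u~w p) ⊆B = step (⊆B (here refl)) u~w (restrict p (⊆B ∘ there))

  weaken : A ⊆ B → Walk A k u v → Walk B k u v
  weaken A⊆B p = restrict p (A⊆B ∘ ∈vertices⇒∈ p)

  _++_ : Walk A j u w → Walk A k w v → Walk A (j ℕ.+ k) u v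
  [ _ ]          ++ q = q
  step u∈A u~w p ++ q = step u∈A u~w (p ++ q)

  reverse : Walk A k u v → Walk A k v u
  reverse [ u∈A ] = [ u∈A ]
  reverse {A = A} {suc k} {u} {v} (step u∈A u~w p) =
    subst (λ m → Walk A m v u) (+-comm k 1)
          (reverse p ++ step (start∈ p) (trans (Graph.sym G _ u) u~w) [ u∈A ])

  adjIn-intro : u ∈ A → w ∈ A → Adjacent G u w → T (adjIn G A u w)
  adjIn-intro {u = u} {A = A} {w = w} u∈A w∈A u~w =
    from (T-∧ {inA A u})
      (does-complete (u ∈? A) u∈A , from (T-∧ {inA A w}) (does-complete (w ∈? A) w∈A , from T-≡ u~w))

  adjIn-elim : T (adjIn G A u w) → u ∈ A × Adjacent G u w
  adjIn-elim {A = A} {u = u} {w = w} t with to (T-∧ {inA A u}) t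
  ... | u∈A , t′ = does-sound (u ∈? A) u∈A , to T-≡ (proj₂ (to (T-∧ {inA A w}) t′))

  within-complete : Walk A j u v → j ≤ k → T (within G A k u v)
  within-complete {A = A} {u = u} {k = zero} [ u∈A ] _ =
    from (T-∧ {inA A u}) (does-complete (u ∈? A) u∈A , does-complete (u ≟ u) refl)
  within-complete {A = A} {u = u} {k = suc k} [ u∈A ] _ =
    from (T-∨ {within G A k u u}) (inj₁ (within-complete {k = k} [ u∈A ] z≤n))
  within-complete {A = A} {u = u} {v = v} {k = suc k} (step {w = w} u∈A u~w p) (s≤s j≤k) =
    from (T-∨ {within G A k u v}) (inj₂ (anyFin-complete (λ x → adjIn G A u x ∧ within G A k x v) w
      (from (T-∧ {adjIn G A u w}) (adjIn-intro u∈A (start∈ p) u~w , within-complete p j≤k))))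

  within-sound : ∀ k → T (within G A k u v) → ∃[ j ] j ≤ k × Walk A j u v
  within-sound {A = A} {u = u} {v = v} zero t with to (T-∧ {inA A u}) t
  ... | u∈A , u≟v with does-sound (u ≟ v) u≟v
  ...   | refl = 0 , z≤n , [ does-sound (u ∈? A) u∈A ]
  within-sound {A = A} {u = u} {v = v} (suc k) t with to (T-∨ {within G A k u v}) t
  ... | inj₁ t′ with within-sound k t′
  ...   | j , j≤k , p = j , m≤n⇒m≤1+n j≤k , p
  within-sound {A = A} {u = u} {v = v} (suc k) t | inj₂ t′
    with anyFin-sound (λ x → adjIn G A u x ∧ within G A k x v) t′
  ... | w , tw with to (T-∧ {adjIn G A u w}) tw
  ...   | t-uw , t-wv with adjIn-elim t-uw | within-sound k t-wv
  ...     | u∈A , u~w | j , j≤k , p = suc j , s≤s j≤k , step u∈A u~w p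

  shortest-exists : Walk A k u v → ∃[ d ] Σ (Walk A d u v) IsShortest
  shortest-exists = descend (<-wellFounded _)
    where
    descend : Acc _<_ k → Walk A k u v → ∃[ d ] Σ (Walk A d u v) IsShortest
    descend {k = zero} _ p = 0 , p , λ _ → z≤n
    descend {k = suc k} {A = A} {u = u} {v = v} (acc shorter) p with T? (within G A k u v)
    ... | yes t with within-sound k t
    ...   | j , j≤k , q = descend (shorter (s≤s j≤k)) q
    descend {k = suc k} _ p | no ¬t = suc k , p , λ q → ≰⇒> (¬t ∘ within-complete q)

  shortest-unique : (p : Walk A d u v) → IsShortest p → Unique (vertices p)
  shortest-unique [ _ ]            _        = [] ∷ []
  shortest-unique (step u∈A u~w p) shortest =
    All.tabulate u∉p ∷ shortest-unique p (λ q → ≤-pred (shortest (step u∈A u~w q)))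
    where
    u∉p : ∀ {x} → x ∈ₗ vertices p → _ ≢ x
    u∉p x∈p refl with suffix p x∈p
    ... | j , j≤k , q = <⇒≱ (s≤s j≤k) (shortest q)

  shortest<n : (p : Walk A d u v) → IsShortest p → d < n
  shortest<n p shortest =
    subst (_≤ n) (vertices-length p) (unique⇒length≤ (shortest-unique p shortest))

  within⇒shortest≤ : (p : Walk A d u v) → IsShortest p → T (within G A k u v) → d ≤ k
  within⇒shortest≤ {k = k} _ shortest t with within-sound k t
  ... | j , j≤k , q = ≤-trans (shortest q) j≤k

  ¬within⇒<shortest : (p : Walk A d u v) → ∀ {s} → within G A s u v ≡ false → s ≤ d → s < d
  ¬within⇒<shortest p eq s≤d = ≤∧≢⇒< s≤d λ { refl → subst T eq (within-complete p ≤-refl) }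

  search-shortest : (p : Walk A d u v) → IsShortest p →
                    ∀ r s → s ≤ d → d ≤ s ℕ.+ r → search G A u v s r ≡ just d
  search-shortest {A = A} {d = d} {u = u} {v = v} p shortest zero s s≤d d≤s
    with within G A s u v in eq
  ... | true  = cong just (≤-antisym s≤d (within⇒shortest≤ p shortest (from T-≡ eq)))
  ... | false = contradiction (subst (d ≤_) (+-identityʳ s) d≤s) (<⇒≱ (¬within⇒<shortest p eq s≤d))
  search-shortest {A = A} {d = d} {u = u} {v = v} p shortest (suc r) s s≤d d≤s+r
    with within G A s u v in eq
  ... | true  = cong just (≤-antisym s≤d (within⇒shortest≤ p shortest (from T-≡ eq)))
  ... | false = search-shortest p shortest r (suc s) (¬within⇒<shortest p eq s≤d)
                                (subst (d ≤_) (+-suc s r) d≤s+r)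

  search-unreachable : (∀ {k} → ¬ Walk A k u v) → ∀ r s → search G A u v s r ≡ nothing
  search-unreachable {A = A} {u = u} {v = v} none zero s with within G A s u v in eq
  ... | true  = contradiction (proj₂ (proj₂ (within-sound s (from T-≡ eq)))) none
  ... | false = refl
  search-unreachable {A = A} {u = u} {v = v} none (suc r) s with within G A s u v in eq
  ... | true  = contradiction (proj₂ (proj₂ (within-sound s (from T-≡ eq)))) none
  ... | false = search-unreachable none r (suc s)

  dist-shortest : (p : Walk A d u v) → IsShortest p → dist G A u v ≡ just d
  dist-shortest p shortest = search-shortest p shortest n 0 z≤n (<⇒≤ (shortest<n p shortest))

  dist-unreachable : (∀ {k} → ¬ Walk A k u v) → dist G A u v ≡ nothing
  dist-unreachable none = search-unreachable none n 0

  path⇒walk : Path G u v → ∃[ k ] Walk ⊤ k u v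
  path⇒walk P = go (Path.verts P) (Path.start P) (Path.end P) (Path.chain P)
    where
    go : (xs : List (Fin n)) → head xs ≡ just u → last xs ≡ just v →
         Linked (Adjacent G) xs → ∃[ k ] Walk ⊤ k u v
    go (_ ∷ [])     refl refl _        = 0 , [ ∈⊤ ]
    go (_ ∷ y ∷ ys) refl l    (x~y ∷ ~s) with go (y ∷ ys) refl l ~s
    ... | k , p = suc k , step ∈⊤ x~y p

  reciprocal-distance : Subset n → Fin n → Fin n → ℚ
  reciprocal-distance A a b = if inA A a ∧ inA A b then recip (dist G A a b) else 0ℚ

  reciprocal-distance-shortest : (p : Walk A d a b) → IsShortest p →
                                 reciprocal-distance A a b ≡ recip (just d)
  reciprocal-distance-shortest {A = A} {a = a} {b = b} p shortest
    rewrite dec-true (a ∈? A) (start∈ p) | dec-true (b ∈? A) (end∈ p) | dist-shortest p shortest = refl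

  reciprocal-distance-unreachable : (∀ {k} → ¬ Walk A k a b) → reciprocal-distance A a b ≡ 0ℚ
  reciprocal-distance-unreachable {A = A} {a = a} {b = b} none =
    trans (if-cong-then (inA A a ∧ inA A b) (cong recip (dist-unreachable none))) (if-eta _)

module Cycles {n : ℕ} (G : Graph n) where
  open Walks G

  private
    variable
      A : Subset n
      k d : ℕ
      a b v : Fin n

  cycle-around : ∀ {x y} → Adjacent G x v → Adjacent G v y → x ≢ y → Walk (∁ ⁅ v ⁆) k y x →
                 Cycle G
  cycle-around {v = v} {x = x} x~v v~y x≢y q with shortest-exists q
  ... | _ , [ _ ]          , _        = contradiction refl x≢y
  ... | _ , p@(step _ _ _) , shortest = record
    { verts    = v ∷ vertices p
    ; long     = s≤s (s≤s (s≤s z≤n))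
    ; distinct = All.tabulate (λ z∈p v≡z → x∈∁⁅y⁆⇒x≢y (∈vertices⇒∈ p z∈p) (sym v≡z))
                 ∷ shortest-unique p shortest
    ; chain    = v~y ∷ vertices-linked p
    ; closes   = v , x , refl , vertices-last p , x~v
    }

  -- How a walk from a to b passes through v once: x and y are the neighbours of v on it,
  -- before and after are its two halves, which avoid v.
  record Crossing (v a b : Fin n) : Set where
    field
      {x y}  : Fin n
      {i j}  : ℕ
      x~v    : Adjacent G x v
      v~y    : Adjacent G v y
      x≢y    : x ≢ y
      before : Walk (∁ ⁅ v ⁆) i a x
      after  : Walk (∁ ⁅ v ⁆) j y b

  crossing : (p : Walk A k a b) → Unique (vertices p) → v ∈ₗ vertices p → v ≢ a → v ≢ b →
             Crossing v a b
  crossing _ _ (here refl) v≢a _ = contradiction refl v≢a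
  crossing {v = v} (step {w = w} _ a~w p) (_ ∷ up) (there v∈p) v≢a v≢b with v ≟ w
  crossing (step _ _ [ _ ])            _               _ _   v≢b | yes refl = contradiction refl v≢b
  crossing (step _ a~v (step _ v~y p)) (a∉p ∷ v∉p ∷ _) _ v≢a _   | yes refl = record
    { x~v    = a~v
    ; v~y    = v~y
    ; x≢y    = All.lookup a∉p (there (here refl))
    ; before = [ x≢y⇒x∈∁⁅y⁆ (v≢a ∘ sym) ]
    ; after  = restrict p (λ z∈p → x≢y⇒x∈∁⁅y⁆ (All.lookup v∉p z∈p ∘ sym))
    }
  ... | no v≢w = let c = crossing p up v∈p v≢w v≢b in record
    { x~v    = Crossing.x~v c
    ; v~y    = Crossing.v~y c
    ; x≢y    = Crossing.x≢y c
    ; before = step (x≢y⇒x∈∁⁅y⁆ (v≢a ∘ sym)) a~w (Crossing.before c)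
    ; after  = Crossing.after c
    }

  path-vertex-separates : ¬ Cycle G → (p : Walk A k a b) → Unique (vertices p) → v ∈ₗ vertices p →
                          ¬ Walk (∁ ⁅ v ⁆) d a b
  path-vertex-separates {a = a} {b = b} {v = v} acyclic p up v∈p r with v ≟ a | v ≟ b
  ... | yes refl | _        = x∈∁⁅y⁆⇒x≢y (start∈ r) refl
  ... | no _     | yes refl = x∈∁⁅y⁆⇒x≢y (end∈ r) refl
  ... | no v≢a   | no v≢b   =
    acyclic (cycle-around x~v v~y x≢y (after ++ (reverse r ++ before)))
    where open Crossing (crossing p up v∈p v≢a v≢b)

module _ {n : ℕ} {T : Graph n} (tree : IsTree T) where
  open Walks T
  open Cycles T

  ∑-vertex-deletions : ∀ {a b} → a ≢ b →
    ∑ (λ v → reciprocal-distance ⊤ a b - reciprocal-distance (∁ ⁅ v ⁆) a b)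
      ≡ 1ℚ + reciprocal-distance ⊤ a b
  ∑-vertex-deletions {a} {b} a≢b with shortest-exists (proj₂ (path⇒walk (proj₁ tree a b)))
  ... | zero  , [ _ ] , _        = contradiction refl a≢b
  ... | suc e , p     , shortest = begin
    ∑ (λ v → d⊤ - d∖ v)                                  ≡⟨ ∑-cong on-or-off-path ⟩
    ∑ (λ v → if does (v ∈ₗ? vertices p) then q else 0ℚ)  ≡⟨ ∑-∈ (shortest-unique p shortest) q ⟩
    length (vertices p) · q                              ≡⟨ cong (_· q) (vertices-length p) ⟩
    q + suc e · q                                        ≡⟨ cong (_+_ q) (·-reciprocal e) ⟩
    q + 1ℚ                                               ≡⟨ ℚP.+-comm q 1ℚ ⟩
    1ℚ + q                                               ≡⟨ cong (_+_ 1ℚ) (sym d⊤≡q) ⟩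
    1ℚ + d⊤                                              ∎
    where
    q d⊤ : ℚ
    q = + 1 / suc e
    d⊤ = reciprocal-distance ⊤ a b
    d∖ : Fin n → ℚ
    d∖ v = reciprocal-distance (∁ ⁅ v ⁆) a b

    d⊤≡q : d⊤ ≡ q
    d⊤≡q = reciprocal-distance-shortest p shortest

    off-path-shortest : ∀ {v} → ¬ v ∈ₗ vertices p → d∖ v ≡ q
    off-path-shortest v∉p = reciprocal-distance-shortest
      (restrict p (λ z∈p → x≢y⇒x∈∁⁅y⁆ λ { refl → v∉p z∈p }))
      (shortest ∘ weaken ⊆⊤)

    on-or-off-path : ∀ v → d⊤ - d∖ v ≡ (if does (v ∈ₗ? vertices p) then q else 0ℚ)
    on-or-off-path v = by-cases (v ∈ₗ? vertices p)
      where
      by-cases : (v∈?p : Dec (v ∈ₗ vertices p)) → d⊤ - d∖ v ≡ (if does v∈?p then q else 0ℚ)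
      by-cases (yes v∈p) = begin
        d⊤ - d∖ v  ≡⟨ cong₂ _-_ d⊤≡q (reciprocal-distance-unreachable
                       (path-vertex-separates (proj₂ tree) p (shortest-unique p shortest) v∈p)) ⟩
        q - 0ℚ     ≡⟨ ℚP.+-identityʳ q ⟩
        q          ∎
      by-cases (no v∉p) = begin
        d⊤ - d∖ v  ≡⟨ cong₂ _-_ d⊤≡q (off-path-shortest v∉p) ⟩
        q - q      ≡⟨ ℚP.+-inverseʳ q ⟩
        0ℚ         ∎

lemma15 : (n : ℕ) (T : Graph n) → IsTree T →
            ∑ (λ v → utilityV T v) ≡ (+ (n C 2) / 1) + IGL T
lemma15 n T tree = begin
  ∑ (λ v → ∑pairs (d ⊤) - ∑pairs (d (∁ ⁅ v ⁆)))
    ≡⟨ ∑-cong (λ v → sym (∑pairs-distrib _-_ refl ∑-distrib-− (d ⊤) (d (∁ ⁅ v ⁆)))) ⟩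
  ∑ (λ v → ∑pairs (λ a b → d ⊤ a b - d (∁ ⁅ v ⁆) a b))
    ≡⟨ ∑-∑pairs-comm (λ v a b → d ⊤ a b - d (∁ ⁅ v ⁆) a b) ⟩
  ∑pairs (λ a b → ∑ (λ v → d ⊤ a b - d (∁ ⁅ v ⁆) a b))
    ≡⟨ ∑pairs-cong (∑-vertex-deletions tree ∘ <⇒≢) ⟩
  ∑pairs (λ a b → 1ℚ + d ⊤ a b)
    ≡⟨ ∑pairs-distrib _+_ refl ∑-distrib-+ (λ _ _ → 1ℚ) (d ⊤) ⟩
  ∑pairs {n} (λ _ _ → 1ℚ) + IGL T
    ≡⟨ cong (_+ IGL T) (trans (∑pairs-const n 1ℚ) (·1≡/1 (n C 2))) ⟩
  + (n C 2) / 1 + IGL T ∎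
  where open Walks T using () renaming (reciprocal-distance to d)
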